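{- There is a constant $c>0$ such that for all sufficiently large $n$, any sequence of triangle solitaire moves transforming one of the three edges $\{0,\dots,n-1\}\times\{0\}$, $\{0\}\times\{0,\dots,n-1\}$, $\{(a,n-1-a):0\le a\le n-1\}$ of $T_n$ into another one has length at least $cn^2$; i.e. the distance between two distinct edges of $T_n$ is $\Omega(n^2)$.
   Context: $T=\{(0,0),(1,0),(0,1)\}$, $T_n=\{(a,b)\in\{0,\dots,n-1\}^2:a+b\le n-1\}$. A triangle solitaire move is a pair $(P,Q)$ of subsets of $\mathbb{Z}^2$ with $|P\cap(\vec v+T)|=|Q\cap(\vec v+T)|=2$ and $P\triangle Q$ a $2$-element subset of $\vec v+T$ for some $\vec v$. -}

module Defs where

open import Data.Bool using (Bool; true; false; _∧_; _xor_)
open import Data.Nat as ℕ using (ℕ; zero; suc)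
open import Data.Integer as ℤ using (ℤ; +_; _+_; _≟_; _≤?_)
open import Data.Product using (Σ; _×_; _,_; ∃)
open import Data.List using (List; _∷_; []; filter; length; map)
open import Data.Fin using (Fin) renaming (zero to f0; suc to fs)
open import Relation.Nullary.Decidable using (⌊_⌋)
open import Relation.Binary.PropositionalEquality using (_≡_)
open import Function using (_∘_)

Point : Set
Point = ℤ × ℤ

Subset : Set
Subset = Point → Bool

_+ᵖ_ : Point → Point → Point
(a , b) +ᵖ (c , d) = (a + c , b + d)

_==ᵖ_ : Point → Point → Bool
(a , b) ==ᵖ (c , d) = ⌊ a ≟ c ⌋ ∧ ⌊ b ≟ d ⌋

T : List Point
T = (+ 0 , + 0) ∷ (+ 1 , + 0) ∷ (+ 0 , + 1) ∷ []

tri : Point → List Point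
tri v = map (v +ᵖ_) T

inTri : Point → Point → Bool
inTri v x = Data.List.foldr (λ p r → Data.Bool._∨_ (p ==ᵖ x) r) false (tri v)
  where import Data.List ; import Data.Bool

countTri : Point → (Point → Bool) → ℕ
countTri v f = length (filter (λ x → Data.Bool.T? (f x)) (tri v))
  where import Data.Bool

_△_ : Subset → Subset → Subset
(P △ Q) x = P x xor Q x

MoveAt : Point → Subset → Subset → Set
MoveAt v P Q =
  (countTri v P ≡ 2) × (countTri v Q ≡ 2) ×
  ((∀ x → inTri v x ≡ false → (P △ Q) x ≡ false) × (countTri v (P △ Q) ≡ 2))

Move : Subset → Subset → Set
Move P Q = ∃ λ v → MoveAt v P Q

data Moves : ℕ → Subset → Subset → Set where
  done : ∀ {P Q} → (∀ x → P x ≡ Q x) → Moves zero P Q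
  step : ∀ {k P Q R} → Move P Q → Moves k Q R → Moves (suc k) P R

edge : Fin 3 → ℕ → Subset
edge f0 n (a , b) = ⌊ b ≟ + 0 ⌋ ∧ (⌊ + 0 ≤? a ⌋ ∧ ⌊ a + + 1 ≤? + n ⌋)
edge (fs f0) n (a , b) = ⌊ a ≟ + 0 ⌋ ∧ (⌊ + 0 ≤? b ⌋ ∧ ⌊ b + + 1 ≤? + n ⌋)
edge (fs (fs f0)) n (a , b) =
  ⌊ + 0 ≤? a ⌋ ∧ (⌊ + 0 ≤? b ⌋ ∧ ⌊ a + b + + 1 ≟ + n ⌋)

-- A move (P, Q) at v exchanges one corner of v + T for another: P and Q agree off v + T and
-- each misses exactly one of its corners. Hence if a weight w : ℤ² → ℕ changes by at most 1
-- between corners of any translate of T, the potential Φ P = Σ_{p ∈ P} w p changes by at most 1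
-- per move. The weight (a, b) ↦ a vanishes on the edge a = 0 and sums to n(n-1)/2 along b = 0;
-- the weight (a, b) ↦ n - 1 - a - b vanishes on the diagonal edge and sums to n(n-1)/2 along
-- either axis edge. Capping both by the depth inside a large box makes Φ a finite sum without
-- changing them on T_n, so distinct edges are at least n(n-1)/2 ≥ n²/4 moves apart for n ≥ 2.
module Submission where

open import Defs
open import Data.Bool using (Bool; true; false; not; _∧_; _xor_; if_then_else_; T?)
open import Data.Bool.Properties using (∧-zeroʳ)
open import Data.Nat
open import Data.Nat.Properties
open import Data.Nat.Tactic.RingSolver using (solve-∀)
open import Data.Integer as ℤ using (ℤ; +_; -[1+_])
import Data.Integer.Properties as ℤₚ
open import Data.Integer.Tactic.RingSolver renaming (solve-∀ to ℤ-solve)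
open import Data.Fin as Fin using (Fin) renaming (zero to f0; suc to fs)
open import Data.Fin.Properties using (all?)
open import Data.List using (List; []; _∷_; _++_; filter; length; lookup; allFin)
open import Data.Product using (Σ; ∃; _×_; _,_; proj₁; proj₂)
open import Data.Sum as Sum using (_⊎_; inj₁; inj₂)
open import Data.Empty using (⊥-elim)
open import Function using (_∘_; case_of_)
open import Relation.Nullary using (¬_; Dec; yes; no)
open import Relation.Nullary.Decidable using (⌊_⌋; True; toWitness; dec-true; dec-false; isYes≗does)
open import Relation.Binary.PropositionalEquality

-- Finite sums over lists and integer ranges

∑ : {A : Set} → List A → (A → ℕ) → ℕ
∑ []       f = 0
∑ (x ∷ xs) f = f x + ∑ xs f

syntax ∑ xs (λ x → e) = ∑[ x ∈ xs ] e

module _ {A : Set} where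

  ∑-cong : ∀ xs {f g : A → ℕ} → (∀ x → f x ≡ g x) → ∑ xs f ≡ ∑ xs g
  ∑-cong []       f≗g = refl
  ∑-cong (x ∷ xs) f≗g = cong₂ _+_ (f≗g x) (∑-cong xs f≗g)

  ∑-mono-≤ : ∀ xs {f g : A → ℕ} → (∀ x → f x ≤ g x) → ∑ xs f ≤ ∑ xs g
  ∑-mono-≤ []       f≤g = z≤n
  ∑-mono-≤ (x ∷ xs) f≤g = +-mono-≤ (f≤g x) (∑-mono-≤ xs f≤g)

  ∑-+ : ∀ xs (f g : A → ℕ) → ∑[ x ∈ xs ] (f x + g x) ≡ ∑ xs f + ∑ xs g
  ∑-+ []       f g = refl
  ∑-+ (x ∷ xs) f g rewrite ∑-+ xs f g = interchange (f x) (g x) (∑ xs f) (∑ xs g)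
    where
    interchange : ∀ a b c d → a + b + (c + d) ≡ a + c + (b + d)
    interchange = solve-∀

  ∑-++ : ∀ xs ys (f : A → ℕ) → ∑ (xs ++ ys) f ≡ ∑ xs f + ∑ ys f
  ∑-++ []       ys f = refl
  ∑-++ (x ∷ xs) ys f rewrite ∑-++ xs ys f = sym (+-assoc (f x) _ _)

  ∑-zero : ∀ xs {f : A → ℕ} → (∀ x → f x ≡ 0) → ∑ xs f ≡ 0
  ∑-zero []       f≗0 = refl
  ∑-zero (x ∷ xs) f≗0 rewrite f≗0 x = ∑-zero xs f≗0

  ∑-if : ∀ xs b (f : A → ℕ) → ∑[ x ∈ xs ] (if b then f x else 0) ≡ (if b then ∑ xs f else 0)
  ∑-if xs true  f = refl
  ∑-if xs false f = ∑-zero xs (λ _ → refl)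

if-∧ : ∀ x y n → (if x ∧ y then n else 0) ≡ (if y then (if x then n else 0) else 0)
if-∧ true  y     n = refl
if-∧ false true  n = refl
if-∧ false false n = refl

if-0 : ∀ b → (if b then 0 else 0) ≡ 0
if-0 true  = refl
if-0 false = refl

≤-if-true : ∀ {b m x} → b ≡ true → m ≤ x → m ≤ (if b then x else 0)
≤-if-true refl m≤x = m≤x

range : ℤ → ℕ → List ℤ
range lo zero      = []
range lo (suc len) = lo ∷ range (ℤ.suc lo) len

suc[i]+n≡i+suc[n] : ∀ i n → ℤ.suc i ℤ.+ + n ≡ i ℤ.+ + suc n
suc[i]+n≡i+suc[n] i n = shift i (+ n)
  where
  shift : ∀ a b → (+ 1 ℤ.+ a) ℤ.+ b ≡ a ℤ.+ (+ 1 ℤ.+ b)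
  shift = ℤ-solve

range-++ : ∀ lo m k → range lo (m + k) ≡ range lo m ++ range (lo ℤ.+ + m) k
range-++ lo zero    k = cong (λ c → range c k) (sym (ℤₚ.+-identityʳ lo))
range-++ lo (suc m) k = cong (lo ∷_) (trans (range-++ (ℤ.suc lo) m k)
  (cong (λ c → range (ℤ.suc lo) m ++ range c k) (suc[i]+n≡i+suc[n] lo m)))

∑-range-++ : ∀ lo m k (f : ℤ → ℕ) →
  ∑ (range lo (m + k)) f ≡ ∑ (range lo m) f + ∑ (range (lo ℤ.+ + m) k) f
∑-range-++ lo m k f = trans (cong (λ cs → ∑ cs f) (range-++ lo m k)) (∑-++ (range lo m) _ f)

∑-range-sub : ∀ lo a m {len} (f : ℤ → ℕ) → a + m ≤ len →
  ∑ (range (lo ℤ.+ + a) m) f ≤ ∑ (range lo len) f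
∑-range-sub lo a m {len} f a+m≤len = begin
  ∑ (range (lo ℤ.+ + a) m) f                                ≤⟨ m≤n+m _ _ ⟩
  ∑ (range lo a) f + ∑ (range (lo ℤ.+ + a) m) f             ≡⟨ ∑-range-++ lo a m f ⟨
  ∑ (range lo (a + m)) f                                    ≤⟨ m≤m+n _ _ ⟩
  ∑ (range lo (a + m)) f + ∑ (range (lo ℤ.+ + (a + m)) r) f ≡⟨ ∑-range-++ lo (a + m) r f ⟨
  ∑ (range lo (a + m + r)) f                                ≡⟨ cong (λ l → ∑ (range lo l) f) a+m+r≡len ⟩
  ∑ (range lo len) f                                        ∎
  where
  open ≤-Reasoning
  r = len ∸ (a + m)
  a+m+r≡len : a + m + r ≡ len
  a+m+r≡len = m+[n∸m]≡n a+m≤len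

∑-range-point : ∀ lo {a len} (f : ℤ → ℕ) → a < len → f (lo ℤ.+ + a) ≤ ∑ (range lo len) f
∑-range-point lo {a} {len} f a<len =
  ≤-trans (m≤m+n _ 0) (∑-range-sub lo a 1 f (subst (_≤ len) (+-comm 1 a) a<len))

InRange : ℤ → ℕ → ℤ → Set
InRange lo len c = lo ℤ.≤ c × c ℤ.< lo ℤ.+ + len

∑-indicator-below : ∀ {z lo} len (f : ℤ → ℕ) → z ℤ.< lo →
  ∑[ c ∈ range lo len ] (if ⌊ z ℤ.≟ c ⌋ then f c else 0) ≡ 0
∑-indicator-below zero f z<lo = refl
∑-indicator-below {z} {lo} (suc len) f z<lo with z ℤ.≟ lo
... | yes refl = ⊥-elim (ℤₚ.<-irrefl refl z<lo)
... | no _     = ∑-indicator-below len f (ℤₚ.<-≤-trans z<lo (ℤₚ.i≤suc[i] lo))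

∑-indicator : ∀ {z} lo len (f : ℤ → ℕ) → InRange lo len z ⊎ f z ≡ 0 →
  ∑[ c ∈ range lo len ] (if ⌊ z ℤ.≟ c ⌋ then f c else 0) ≡ f z
∑-indicator lo zero f (inj₁ (lo≤z , z<lo+0)) =
  ⊥-elim (ℤₚ.<⇒≱ (subst (_ ℤ.<_) (ℤₚ.+-identityʳ lo) z<lo+0) lo≤z)
∑-indicator lo zero f (inj₂ fz≡0) = sym fz≡0
∑-indicator {z} lo (suc len) f z∈range⊎fz≡0 with z ℤ.≟ lo
... | yes refl = trans (cong (λ t → f z + t) (∑-indicator-below len f (ℤₚ.suc[i]≤j⇒i<j ℤₚ.≤-refl)))
                       (+-identityʳ (f z))
... | no z≢lo  = ∑-indicator (ℤ.suc lo) len f (Sum.map₁ shrink z∈range⊎fz≡0)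
  where
  shrink : InRange lo (suc len) z → InRange (ℤ.suc lo) len z
  shrink (lo≤z , z<hi) = ℤₚ.i<j⇒suc[i]≤j (ℤₚ.≤∧≢⇒< lo≤z (z≢lo ∘ sym))
                       , subst (z ℤ.<_) (sym (suc[i]+n≡i+suc[n] lo len)) z<hi

sumFrom : (ℕ → ℕ) → ℕ → ℕ → ℕ
sumFrom h s zero    = 0
sumFrom h s (suc l) = h s + sumFrom h (suc s) l

sumFrom-≤-∑-range : ∀ (h : ℕ → ℕ) (f : ℤ → ℕ) s l →
  (∀ i → s ≤ i → i < s + l → h i ≤ f (+ i)) → sumFrom h s l ≤ ∑ (range (+ s) l) f
sumFrom-≤-∑-range h f s zero    h≤f = z≤n
sumFrom-≤-∑-range h f s (suc l) h≤f =
  +-mono-≤ (h≤f s ≤-refl (m<m+n s z<s))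
           (sumFrom-≤-∑-range h f (suc s) l λ i s<i i<1+s+l →
             h≤f i (<⇒≤ s<i) (subst (i <_) (sym (+-suc s l)) i<1+s+l))

triangular : ℕ → ℕ
triangular n = sumFrom (λ i → i) 0 n

sumFrom-ascending : ∀ s l → 2 * sumFrom (λ i → i) s l + l ≡ l * (2 * s + l)
sumFrom-ascending s zero    = refl
sumFrom-ascending s (suc l) = begin
  2 * (s + S) + suc l             ≡⟨ regroup s S l ⟩
  2 * s + (2 * S + l) + 1         ≡⟨ cong (λ t → 2 * s + t + 1) (sumFrom-ascending (suc s) l) ⟩
  2 * s + l * (2 * suc s + l) + 1 ≡⟨ expand s l ⟩
  suc l * (2 * s + suc l)         ∎
  where
  open ≡-Reasoning
  S = sumFrom (λ i → i) (suc s) l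
  regroup : ∀ s S l → 2 * (s + S) + suc l ≡ 2 * s + (2 * S + l) + 1
  regroup = solve-∀
  expand : ∀ s l → 2 * s + l * (2 * suc s + l) + 1 ≡ suc l * (2 * s + suc l)
  expand = solve-∀

sumFrom-descending : ∀ n s l → s + l ≡ n → 2 * sumFrom (λ i → n ∸ suc i) s l + l ≡ l * l
sumFrom-descending n s zero    _     = refl
sumFrom-descending n s (suc l) s+l≡n = begin
  2 * (n ∸ suc s + S) + suc l ≡⟨ cong (λ t → 2 * (t + S) + suc l) n∸[1+s]≡l ⟩
  2 * (l + S) + suc l         ≡⟨ regroup l S ⟩
  2 * l + (2 * S + l) + 1     ≡⟨ cong (λ t → 2 * l + t + 1) (sumFrom-descending n (suc s) l 1+s+l≡n) ⟩
  2 * l + l * l + 1           ≡⟨ expand l ⟩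
  suc l * suc l               ∎
  where
  open ≡-Reasoning
  S = sumFrom (λ i → n ∸ suc i) (suc s) l
  1+s+l≡n : suc s + l ≡ n
  1+s+l≡n = trans (sym (+-suc s l)) s+l≡n
  n∸[1+s]≡l : n ∸ suc s ≡ l
  n∸[1+s]≡l = trans (cong (_∸ suc s) (sym 1+s+l≡n)) (m+n∸m≡n (suc s) l)
  regroup : ∀ l S → 2 * (l + S) + suc l ≡ 2 * l + (2 * S + l) + 1
  regroup = solve-∀
  expand : ∀ l → 2 * l + l * l + 1 ≡ suc l * suc l
  expand = solve-∀

sumFrom-reflect : ∀ n → sumFrom (λ i → n ∸ suc i) 0 n ≡ triangular n
sumFrom-reflect n = *-cancelˡ-≡ _ _ 2 (+-cancelʳ-≡ n _ _
  (trans (sumFrom-descending n 0 n refl) (sym (sumFrom-ascending 0 n))))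

square≤4*triangular : ∀ n → 2 ≤ n → n * n ≤ 4 * triangular n
square≤4*triangular n 2≤n = +-cancelʳ-≤ (n * n) _ _ (begin
  n * n + n * n             ≡⟨ cong₂ _+_ gauss gauss ⟩
  (2 * t + n) + (2 * t + n) ≡⟨ regroup t n ⟩
  4 * t + 2 * n             ≤⟨ +-monoʳ-≤ (4 * t) (*-monoˡ-≤ n 2≤n) ⟩
  4 * t + n * n             ∎)
  where
  open ≤-Reasoning
  t = triangular n
  gauss : n * n ≡ 2 * t + n
  gauss = sym (sumFrom-ascending 0 n)
  regroup : ∀ t n → (2 * t + n) + (2 * t + n) ≡ 4 * t + 2 * n
  regroup = solve-∀

-- Moves exchange two corners of a triangle

corner : Point → Fin 3 → Point
corner v k = v +ᵖ lookup T k

record Exchange (P Q : Subset) : Set where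
  field
    base          : Point
    source target : Fin 3
    removed∈P : P (corner base source) ≡ true
    removed∉Q : Q (corner base source) ≡ false
    added∉P   : P (corner base target) ≡ false
    added∈Q   : Q (corner base target) ≡ true
    unchanged : ∀ p → corner base source ==ᵖ p ≡ false → corner base target ==ᵖ p ≡ false →
                P p ≡ Q p

Exchange-sym : ∀ {P Q} → Exchange P Q → Exchange Q P
Exchange-sym e = record
  { base = base ; source = target ; target = source
  ; removed∈P = added∈Q ; removed∉Q = added∉P ; added∉P = removed∉Q ; added∈Q = removed∈P
  ; unchanged = λ p a r → sym (unchanged p r a)
  }
  where open Exchange e

⌊⌋-true : ∀ {A : Set} (a? : Dec A) → A → ⌊ a? ⌋ ≡ true
⌊⌋-true a? a = trans (isYes≗does a?) (dec-true a? a)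

⌊⌋-false : ∀ {A : Set} (a? : Dec A) → ¬ A → ⌊ a? ⌋ ≡ false
⌊⌋-false a? ¬a = trans (isYes≗does a?) (dec-false a? ¬a)

==ᵖ-sound : ∀ x y → x ==ᵖ y ≡ true → x ≡ y
==ᵖ-sound (a , b) (c , d) eq with a ℤ.≟ c | b ℤ.≟ d
==ᵖ-sound (a , b) (c , d) _  | yes refl | yes refl = refl
==ᵖ-sound (a , b) (c , d) () | yes _    | no _
==ᵖ-sound (a , b) (c , d) () | no _     | _

==ᵖ-false⇒≢ : ∀ x {y} → x ==ᵖ y ≡ false → x ≢ y
==ᵖ-false⇒≢ (a , b) x≠y refl rewrite ⌊⌋-true (a ℤ.≟ a) refl | ⌊⌋-true (b ℤ.≟ b) refl =
  case x≠y of λ ()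

xor-self : ∀ x → x xor x ≡ false
xor-self true  = refl
xor-self false = refl

xor≡false⇒≡ : ∀ x y → x xor y ≡ false → x ≡ y
xor≡false⇒≡ true  true  _ = refl
xor≡false⇒≡ false false _ = refl

count : (Fin 3 → Bool) → ℕ
count g = ∑[ k ∈ allFin 3 ] (if g k then 1 else 0)

count-false : ∀ g → (∀ k → g k ≡ false) → count g ≡ 0
count-false g g≗false = ∑-zero (allFin 3) (λ k → cong (λ b → if b then 1 else 0) (g≗false k))

count≡2⇒missing-one : ∀ g → count g ≡ 2 → ∃ λ a → ∀ k → g k ≡ not ⌊ k Fin.≟ a ⌋
count≡2⇒missing-one g h with g f0 in e₀ | g (fs f0) in e₁ | g (fs (fs f0)) in e₂
count≡2⇒missing-one g _  | false | true  | true  = f0 , λ { f0 → e₀ ; (fs f0) → e₁ ; (fs (fs f0)) → e₂ }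
count≡2⇒missing-one g _  | true  | false | true  = fs f0 , λ { f0 → e₀ ; (fs f0) → e₁ ; (fs (fs f0)) → e₂ }
count≡2⇒missing-one g _  | true  | true  | false = fs (fs f0) , λ { f0 → e₀ ; (fs f0) → e₁ ; (fs (fs f0)) → e₂ }
count≡2⇒missing-one g () | true  | true  | true
count≡2⇒missing-one g () | true  | false | false
count≡2⇒missing-one g () | false | true  | false
count≡2⇒missing-one g () | false | false | true
count≡2⇒missing-one g () | false | false | false

length-filter : ∀ {A : Set} (f : A → Bool) xs →
  length (filter (λ x → T? (f x)) xs) ≡ ∑[ x ∈ xs ] (if f x then 1 else 0)
length-filter f []       = refl
length-filter f (x ∷ xs) with f x
... | true  = cong suc (length-filter f xs)
... | false = length-filter f xs

countTri≡count : ∀ v f → countTri v f ≡ count (λ k → f (corner v k))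
countTri≡count v f = length-filter f (tri v)

corner-or-outside : ∀ v p → (∃ λ k → corner v k ≡ p) ⊎ inTri v p ≡ false
corner-or-outside v p
  with corner v f0 ==ᵖ p in e₀ | corner v (fs f0) ==ᵖ p in e₁ | corner v (fs (fs f0)) ==ᵖ p in e₂
... | true  | _     | _     = inj₁ (f0 , ==ᵖ-sound _ _ e₀)
... | false | true  | _     = inj₁ (fs f0 , ==ᵖ-sound _ _ e₁)
... | false | false | true  = inj₁ (fs (fs f0) , ==ᵖ-sound _ _ e₂)
... | false | false | false = inj₂ refl

MoveAt⇒Exchange : ∀ {v P Q} → MoveAt v P Q → Exchange P Q
MoveAt⇒Exchange {v} {P} {Q} (P-two , Q-two , same-outside , differ-two)
  with count≡2⇒missing-one _ (trans (sym (countTri≡count v P)) P-two)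
     | count≡2⇒missing-one _ (trans (sym (countTri≡count v Q)) Q-two)
... | a , P≗ | b , Q≗ = record
  { base = v ; source = b ; target = a
  ; removed∈P = trans (P≗ b) (cong not (⌊⌋-false (b Fin.≟ a) (a≢b ∘ sym)))
  ; removed∉Q = trans (Q≗ b) (cong not (⌊⌋-true (b Fin.≟ b) refl))
  ; added∉P   = trans (P≗ a) (cong not (⌊⌋-true (a Fin.≟ a) refl))
  ; added∈Q   = trans (Q≗ a) (cong not (⌊⌋-false (a Fin.≟ b) a≢b))
  ; unchanged = unchanged
  }
  where
  a≢b : a ≢ b
  a≢b refl = case trans (sym differ-two) (trans (countTri≡count v (P △ Q)) (count-false _ P△Q≗false))
             of λ ()
    where
    P△Q≗false : ∀ k → (P △ Q) (corner v k) ≡ false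
    P△Q≗false k = trans (cong (_xor Q (corner v k)) (trans (P≗ k) (sym (Q≗ k)))) (xor-self (Q (corner v k)))
  unchanged : ∀ p → corner v b ==ᵖ p ≡ false → corner v a ==ᵖ p ≡ false → P p ≡ Q p
  unchanged p b≠p a≠p with corner-or-outside v p
  ... | inj₁ (k , refl) = trans (P≗ k) (trans (cong not (⌊⌋-false (k Fin.≟ a) k≢a))
                                               (sym (trans (Q≗ k) (cong not (⌊⌋-false (k Fin.≟ b) k≢b)))))
    where
    k≢a : k ≢ a
    k≢a refl = ==ᵖ-false⇒≢ (corner v k) a≠p refl
    k≢b : k ≢ b
    k≢b refl = ==ᵖ-false⇒≢ (corner v k) b≠p refl
  ... | inj₂ outside = xor≡false⇒≡ (P p) (Q p) (same-outside p outside)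

Move⇒Exchange : ∀ {P Q} → Move P Q → Exchange P Q
Move⇒Exchange (v , move) = MoveAt⇒Exchange {v} move

-- Triangle-Lipschitz weights

TriangleLipschitz : (Point → ℕ) → Set
TriangleLipschitz w = ∀ v i j → w (corner v i) ≤ w (corner v j) + 1

TriangleLipschitzℤ : (Point → ℤ) → Set
TriangleLipschitzℤ ℓ = ∀ v i j → ℓ (corner v i) ℤ.≤ ℓ (corner v j) ℤ.+ + 1

⊓-triangleLipschitz : ∀ f g → TriangleLipschitz f → TriangleLipschitz g →
  TriangleLipschitz (λ p → f p ⊓ g p)
⊓-triangleLipschitz f g f-lip g-lip v i j =
  ≤-trans (⊓-mono-≤ (f-lip v i j) (g-lip v i j))
          (≤-reflexive (sym (+-distribʳ-⊓ 1 (f (corner v j)) (g (corner v j)))))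

posPart : ℤ → ℕ
posPart (+ n)    = n
posPart -[1+ n ] = 0

posPart-≤0 : ∀ {x} → x ℤ.≤ + 0 → posPart x ≡ 0
posPart-≤0 {+ zero}    _          = refl
posPart-≤0 {+ suc _}   (ℤ.+≤+ ())
posPart-≤0 { -[1+ _ ]} _          = refl

posPart-neg : ∀ m → posPart (ℤ.- + m) ≡ 0
posPart-neg zero    = refl
posPart-neg (suc m) = refl

posPart[m-n]≡m∸n : ∀ m n → posPart (+ m ℤ.- + n) ≡ m ∸ n
posPart[m-n]≡m∸n m n with n ≤? m
... | yes n≤m = cong posPart (trans (ℤₚ.m-n≡m⊖n m n) (ℤₚ.⊖-≥ n≤m))
... | no n≰m  = trans (cong posPart (trans (ℤₚ.m-n≡m⊖n m n) (ℤₚ.⊖-≰ n≰m)))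
                      (trans (posPart-neg (n ∸ m)) (sym (m≤n⇒m∸n≡0 (<⇒≤ (≰⇒> n≰m)))))

posPart-≤-+1 : ∀ x y → x ℤ.≤ y ℤ.+ + 1 → posPart x ≤ posPart y + 1
posPart-≤-+1 -[1+ _ ] y            _              = z≤n
posPart-≤-+1 (+ m)    (+ n)        (ℤ.+≤+ m≤n+1) = m≤n+1
posPart-≤-+1 (+ m)    -[1+ zero ]  (ℤ.+≤+ m≤0)   = ≤-trans m≤0 z≤n
posPart-≤-+1 (+ m)    -[1+ suc _ ] ()

posPart-triangleLipschitz : ∀ ℓ → TriangleLipschitzℤ ℓ → TriangleLipschitz (posPart ∘ ℓ)
posPart-triangleLipschitz ℓ ℓ-lip v i j = posPart-≤-+1 (ℓ (corner v i)) (ℓ (corner v j)) (ℓ-lip v i j)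

affine : ℤ → ℤ → ℤ → Point → ℤ
affine c α β (x , y) = c ℤ.+ (α ℤ.* x ℤ.+ β ℤ.* y)

CornerSteps : ℤ → ℤ → Set
CornerSteps α β = ∀ i j → affine (+ 0) α β (lookup T i) ℤ.≤ affine (+ 0) α β (lookup T j) ℤ.+ + 1

cornerSteps? : ∀ α β → Dec (CornerSteps α β)
cornerSteps? α β = all? λ i → all? λ j → _ ℤ.≤? _

affine-triangleLipschitz : ∀ c α β → CornerSteps α β → TriangleLipschitzℤ (affine c α β)
affine-triangleLipschitz c α β steps v i j = begin
  affine c α β (corner v i)         ≡⟨ split v (lookup T i) ⟩
  affine c α β v ℤ.+ δ i            ≤⟨ ℤₚ.+-monoʳ-≤ (affine c α β v) (steps i j) ⟩
  affine c α β v ℤ.+ (δ j ℤ.+ + 1)  ≡⟨ ℤₚ.+-assoc (affine c α β v) (δ j) (+ 1) ⟨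
  affine c α β v ℤ.+ δ j ℤ.+ + 1    ≡⟨ cong (ℤ._+ + 1) (split v (lookup T j)) ⟨
  affine c α β (corner v j) ℤ.+ + 1 ∎
  where
  open ℤₚ.≤-Reasoning
  δ : Fin 3 → ℤ
  δ k = affine (+ 0) α β (lookup T k)
  split : ∀ p t → affine c α β (p +ᵖ t) ≡ affine c α β p ℤ.+ affine (+ 0) α β t
  split (x , y) (s , t) = distribute c α β x y s t
    where
    distribute : ∀ c α β x y s t → c ℤ.+ (α ℤ.* (x ℤ.+ s) ℤ.+ β ℤ.* (y ℤ.+ t))
                                 ≡ c ℤ.+ (α ℤ.* x ℤ.+ β ℤ.* y) ℤ.+ (+ 0 ℤ.+ (α ℤ.* s ℤ.+ β ℤ.* t))
    distribute = ℤ-solve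

posPart-affine-triangleLipschitz : ∀ ℓ c α β → (∀ p → ℓ p ≡ affine c α β p) →
  {True (cornerSteps? α β)} → TriangleLipschitz (posPart ∘ ℓ)
posPart-affine-triangleLipschitz ℓ c α β ℓ≗affine {steps} = posPart-triangleLipschitz ℓ λ v i j →
  subst₂ (λ x y → x ℤ.≤ y ℤ.+ + 1) (sym (ℓ≗affine (corner v i))) (sym (ℓ≗affine (corner v j)))
    (affine-triangleLipschitz c α β (toWitness steps) v i j)

-- Weighted potentials on a box

SupportedIn : ℤ → ℕ → (Point → ℕ) → Set
SupportedIn lo len w = ∀ z → w z ≡ 0 ⊎ (InRange lo len (proj₁ z) × InRange lo len (proj₂ z))

module Box (lo : ℤ) (len : ℕ) where

  boxSum : (Point → ℕ) → ℕ
  boxSum f = ∑[ b ∈ range lo len ] ∑[ a ∈ range lo len ] f (a , b)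

  boxSum-cong : ∀ {f g} → (∀ p → f p ≡ g p) → boxSum f ≡ boxSum g
  boxSum-cong f≗g = ∑-cong (range lo len) λ b → ∑-cong (range lo len) λ a → f≗g (a , b)

  boxSum-zero : ∀ {f} → (∀ p → f p ≡ 0) → boxSum f ≡ 0
  boxSum-zero f≗0 = ∑-zero (range lo len) λ b → ∑-zero (range lo len) λ a → f≗0 (a , b)

  boxSum-+ : ∀ f g → boxSum (λ p → f p + g p) ≡ boxSum f + boxSum g
  boxSum-+ f g = trans (∑-cong (range lo len) λ b → ∑-+ (range lo len) (λ a → f (a , b)) (λ a → g (a , b)))
                       (∑-+ (range lo len) _ _)

  boxSum-point : ∀ w → SupportedIn lo len w → ∀ z → boxSum (λ p → if z ==ᵖ p then w p else 0) ≡ w z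
  boxSum-point w w-supported (z₁ , z₂) = begin
    boxSum (λ p → if (z₁ , z₂) ==ᵖ p then w p else 0)
      ≡⟨ ∑-cong R (λ b → trans (∑-cong R λ a → if-∧ ⌊ z₁ ℤ.≟ a ⌋ ⌊ z₂ ℤ.≟ b ⌋ (w (a , b)))
                                (∑-if R ⌊ z₂ ℤ.≟ b ⌋ λ a → if ⌊ z₁ ℤ.≟ a ⌋ then w (a , b) else 0)) ⟩
    ∑[ b ∈ R ] (if ⌊ z₂ ℤ.≟ b ⌋ then ∑[ a ∈ R ] (if ⌊ z₁ ℤ.≟ a ⌋ then w (a , b) else 0) else 0)
      ≡⟨ ∑-cong R (λ b → cong (λ n → if ⌊ z₂ ℤ.≟ b ⌋ then n else 0)
                               (∑-indicator lo len (λ a → w (a , b)) (first-in-range b))) ⟩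
    ∑[ b ∈ R ] (if ⌊ z₂ ℤ.≟ b ⌋ then w (z₁ , b) else 0)
      ≡⟨ ∑-indicator lo len (λ b → w (z₁ , b)) second-in-range ⟩
    w (z₁ , z₂) ∎
    where
    open ≡-Reasoning
    R = range lo len
    first-in-range : ∀ b → InRange lo len z₁ ⊎ w (z₁ , b) ≡ 0
    first-in-range b = Sum.swap (Sum.map₂ proj₁ (w-supported (z₁ , b)))
    second-in-range : InRange lo len z₂ ⊎ w (z₁ , z₂) ≡ 0
    second-in-range = Sum.swap (Sum.map₂ proj₂ (w-supported (z₁ , z₂)))

  boxSum-row : ∀ f a b m → b < len → a + m ≤ len →
    ∑[ c ∈ range (lo ℤ.+ + a) m ] f (c , lo ℤ.+ + b) ≤ boxSum f
  boxSum-row f a b m b<len a+m≤len = begin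
    ∑[ c ∈ range (lo ℤ.+ + a) m ] f (c , y) ≤⟨ ∑-range-sub lo a m (λ c → f (c , y)) a+m≤len ⟩
    ∑[ c ∈ range lo len ] f (c , y)         ≤⟨ ∑-range-point lo (λ y′ → ∑[ c ∈ range lo len ] f (c , y′)) b<len ⟩
    boxSum f                                ∎
    where
    open ≤-Reasoning
    y = lo ℤ.+ + b

  boxSum-column : ∀ f a b m → a < len → b + m ≤ len →
    ∑[ c ∈ range (lo ℤ.+ + b) m ] f (lo ℤ.+ + a , c) ≤ boxSum f
  boxSum-column f a b m a<len b+m≤len = begin
    ∑[ c ∈ range (lo ℤ.+ + b) m ] f (lo ℤ.+ + a , c)
      ≤⟨ ∑-mono-≤ (range (lo ℤ.+ + b) m) (λ c → ∑-range-point lo (λ x → f (x , c)) a<len) ⟩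
    ∑[ c ∈ range (lo ℤ.+ + b) m ] ∑[ x ∈ range lo len ] f (x , c)
      ≤⟨ ∑-range-sub lo b m (λ c → ∑[ x ∈ range lo len ] f (x , c)) b+m≤len ⟩
    boxSum f ∎
    where open ≤-Reasoning

  depth : ℤ → ℕ
  depth c = posPart (c ℤ.- lo) ⊓ posPart ((lo ℤ.+ + len) ℤ.- c)

  boxDepth : Point → ℕ
  boxDepth p = depth (proj₁ p) ⊓ depth (proj₂ p)

  depth≡0⊎InRange : ∀ c → depth c ≡ 0 ⊎ InRange lo len c
  depth≡0⊎InRange c with lo ℤ.≤? c | c ℤ.<? lo ℤ.+ + len
  ... | yes lo≤c | yes c<hi = inj₂ (lo≤c , c<hi)
  ... | no lo≰c  | _        =
    inj₁ (cong (_⊓ posPart ((lo ℤ.+ + len) ℤ.- c))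
               (posPart-≤0 (ℤₚ.i≤j⇒i-j≤0 (ℤₚ.<⇒≤ (ℤₚ.≰⇒> lo≰c)))))
  ... | yes _    | no c≮hi  =
    inj₁ (trans (cong (posPart (c ℤ.- lo) ⊓_) (posPart-≤0 (ℤₚ.i≤j⇒i-j≤0 (ℤₚ.≮⇒≥ c≮hi))))
                (⊓-zeroʳ (posPart (c ℤ.- lo))))

  ⊓-boxDepth-supported : ∀ (f : Point → ℕ) → SupportedIn lo len (λ p → f p ⊓ boxDepth p)
  ⊓-boxDepth-supported f (a , b) with depth≡0⊎InRange a | depth≡0⊎InRange b
  ... | inj₂ a∈ | inj₂ b∈ = inj₂ (a∈ , b∈)
  ... | inj₁ da≡0 | _ rewrite da≡0 = inj₁ (⊓-zeroʳ (f (a , b)))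
  ... | inj₂ _ | inj₁ db≡0 rewrite db≡0 | ⊓-zeroʳ (depth a) = inj₁ (⊓-zeroʳ (f (a , b)))

  boxDepth-triangleLipschitz : TriangleLipschitz boxDepth
  boxDepth-triangleLipschitz =
    ⊓-triangleLipschitz (depth ∘ proj₁) (depth ∘ proj₂)
      (⊓-triangleLipschitz (posPart ∘ from-lo₁) (posPart ∘ to-hi₁)
        (posPart-affine-triangleLipschitz from-lo₁ (ℤ.- lo) (+ 1) (+ 0) λ (x , y) → x-c x y lo)
        (posPart-affine-triangleLipschitz to-hi₁ hi (ℤ.- + 1) (+ 0) λ (x , y) → c-x x y hi))
      (⊓-triangleLipschitz (posPart ∘ from-lo₂) (posPart ∘ to-hi₂)
        (posPart-affine-triangleLipschitz from-lo₂ (ℤ.- lo) (+ 0) (+ 1) λ (x , y) → y-c x y lo)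
        (posPart-affine-triangleLipschitz to-hi₂ hi (+ 0) (ℤ.- + 1) λ (x , y) → c-y x y hi))
    where
    hi = lo ℤ.+ + len
    from-lo₁ to-hi₁ from-lo₂ to-hi₂ : Point → ℤ
    from-lo₁ p = proj₁ p ℤ.- lo
    to-hi₁   p = hi ℤ.- proj₁ p
    from-lo₂ p = proj₂ p ℤ.- lo
    to-hi₂   p = hi ℤ.- proj₂ p
    x-c : ∀ x y c → x ℤ.- c ≡ ℤ.- c ℤ.+ (+ 1 ℤ.* x ℤ.+ + 0 ℤ.* y)
    x-c = ℤ-solve
    c-x : ∀ x y c → c ℤ.- x ≡ c ℤ.+ (ℤ.- + 1 ℤ.* x ℤ.+ + 0 ℤ.* y)
    c-x = ℤ-solve
    y-c : ∀ x y c → y ℤ.- c ≡ ℤ.- c ℤ.+ (+ 0 ℤ.* x ℤ.+ + 1 ℤ.* y)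
    y-c = ℤ-solve
    c-y : ∀ x y c → c ℤ.- y ≡ c ℤ.+ (+ 0 ℤ.* x ℤ.+ ℤ.- + 1 ℤ.* y)
    c-y = ℤ-solve

  module Potential (w : Point → ℕ) (w-supported : SupportedIn lo len w) (w-lipschitz : TriangleLipschitz w)
    where

    Φ : Subset → ℕ
    Φ P = boxSum λ p → if P p then w p else 0

    Φ-cong : ∀ {P Q} → (∀ p → P p ≡ Q p) → Φ P ≡ Φ Q
    Φ-cong P≗Q = boxSum-cong λ p → cong (λ b → if b then w p else 0) (P≗Q p)

    Exchange-balance : ∀ {P Q} (e : Exchange P Q) → let open Exchange e in
      Φ Q + w (corner base source) ≡ Φ P + w (corner base target)
    Exchange-balance {P} {Q} e = begin
      Φ Q + w x                                       ≡⟨ cong (λ t → Φ Q + t) (boxSum-point w w-supported x) ⟨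
      Φ Q + boxSum (λ p → if x ==ᵖ p then w p else 0) ≡⟨ boxSum-+ _ _ ⟨
      boxSum (λ p → (if Q p then w p else 0) + (if x ==ᵖ p then w p else 0)) ≡⟨ boxSum-cong pointwise ⟩
      boxSum (λ p → (if P p then w p else 0) + (if y ==ᵖ p then w p else 0)) ≡⟨ boxSum-+ _ _ ⟩
      Φ P + boxSum (λ p → if y ==ᵖ p then w p else 0) ≡⟨ cong (λ t → Φ P + t) (boxSum-point w w-supported y) ⟩
      Φ P + w y                                       ∎
      where
      open ≡-Reasoning
      open Exchange e
      x = corner base source
      y = corner base target
      at-x : (if Q x then w x else 0) + w x ≡ (if P x then w x else 0) + 0
      at-x rewrite removed∉Q | removed∈P = sym (+-identityʳ (w x))
      at-y : (if Q y then w y else 0) + 0 ≡ (if P y then w y else 0) + w y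
      at-y rewrite added∈Q | added∉P = +-identityʳ (w y)
      pointwise : ∀ p → (if Q p then w p else 0) + (if x ==ᵖ p then w p else 0)
                      ≡ (if P p then w p else 0) + (if y ==ᵖ p then w p else 0)
      pointwise p with x ==ᵖ p in x≡p | y ==ᵖ p in y≡p
      ... | true  | true  = case trans (sym added∈Q) (trans (cong Q y≡x) removed∉Q) of λ ()
        where y≡x = trans (==ᵖ-sound _ _ y≡p) (sym (==ᵖ-sound _ _ x≡p))
      ... | true  | false = subst (λ q → (if Q q then w q else 0) + w q ≡ (if P q then w q else 0) + 0)
                                  (==ᵖ-sound _ _ x≡p) at-x
      ... | false | true  = subst (λ q → (if Q q then w q else 0) + 0 ≡ (if P q then w q else 0) + w q)
                                  (==ᵖ-sound _ _ y≡p) at-y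
      ... | false | false rewrite unchanged p x≡p y≡p = refl

    Exchange⇒Φ≤Φ+1 : ∀ {P Q} → Exchange P Q → Φ P ≤ Φ Q + 1
    Exchange⇒Φ≤Φ+1 {P} {Q} e = +-cancelʳ-≤ (w y) (Φ P) (Φ Q + 1) (begin
      Φ P + w y       ≡⟨ Exchange-balance e ⟨
      Φ Q + w x       ≤⟨ +-monoʳ-≤ (Φ Q) (w-lipschitz base source target) ⟩
      Φ Q + (w y + 1) ≡⟨ shuffle (Φ Q) (w y) ⟩
      Φ Q + 1 + w y   ∎)
      where
      open ≤-Reasoning
      open Exchange e
      x = corner base source
      y = corner base target
      shuffle : ∀ a b → a + (b + 1) ≡ a + 1 + b
      shuffle = solve-∀

    Moves⇒Φ≤Φ+k : ∀ {k P Q} → Moves k P Q → Φ P ≤ Φ Q + k × Φ Q ≤ Φ P + k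
    Moves⇒Φ≤Φ+k (done P≗Q) = ≤-trans (≤-reflexive (Φ-cong P≗Q)) (m≤m+n _ 0)
                           , ≤-trans (≤-reflexive (sym (Φ-cong P≗Q))) (m≤m+n _ 0)
    Moves⇒Φ≤Φ+k {suc k} {P} {R} (step {Q = Q} move moves) with Moves⇒Φ≤Φ+k moves
    ... | Q≤R+k , R≤Q+k = (begin
      Φ P           ≤⟨ Exchange⇒Φ≤Φ+1 exchange ⟩
      Φ Q + 1       ≤⟨ +-monoˡ-≤ 1 Q≤R+k ⟩
      Φ R + k + 1   ≡⟨ +-assoc (Φ R) k 1 ⟩
      Φ R + (k + 1) ≡⟨ cong (λ t → Φ R + t) (+-comm k 1) ⟩
      Φ R + suc k   ∎) , (begin
      Φ R           ≤⟨ R≤Q+k ⟩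
      Φ Q + k       ≤⟨ +-monoˡ-≤ k (Exchange⇒Φ≤Φ+1 (Exchange-sym exchange)) ⟩
      Φ P + 1 + k   ≡⟨ +-assoc (Φ P) 1 k ⟩
      Φ P + suc k   ∎)
      where
      open ≤-Reasoning
      exchange = Move⇒Exchange move

    separation : ∀ {k P Q} s → s ≤ Φ P → Φ Q ≡ 0 → Moves k P Q ⊎ Moves k Q P → s ≤ k
    separation s s≤ΦP ΦQ≡0 (inj₁ P→Q) =
      ≤-trans s≤ΦP (≤-trans (proj₁ (Moves⇒Φ≤Φ+k P→Q)) (≤-reflexive (cong (_+ _) ΦQ≡0)))
    separation s s≤ΦP ΦQ≡0 (inj₂ Q→P) =
      ≤-trans s≤ΦP (≤-trans (proj₂ (Moves⇒Φ≤Φ+k Q→P)) (≤-reflexive (cong (_+ _) ΦQ≡0)))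

-- The edges of T_n

-- On the box [-n, 2n]², boxDepth is at least n at every point of T_n, so capping a weight by it
-- changes nothing on the edges.
module Edges (n : ℕ) where

  open Box (ℤ.- + n) (n + suc (n + n))

  lo+n≡0 : ℤ.- + n ℤ.+ + n ≡ + 0
  lo+n≡0 = ℤₚ.+-inverseˡ (+ n)

  n<len : n < n + suc (n + n)
  n<len = m<m+n n z<s

  n+n≤len : n + n ≤ n + suc (n + n)
  n+n≤len = +-monoʳ-≤ n (≤-trans (m≤m+n n n) (n≤1+n _))

  n≤depth : ∀ {i} → i ≤ n → n ≤ depth (+ i)
  n≤depth {i} i≤n = ⊓-glb (≤-trans (m≤n+m n i) (≤-reflexive (sym above-lo))) (begin
    n                                                 ≤⟨ m+n≤o⇒m≤o∸n n n+i≤2n+1 ⟩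
    suc (n + n) ∸ i                                   ≡⟨ posPart[m-n]≡m∸n (suc (n + n)) i ⟨
    posPart (+ suc (n + n) ℤ.- + i)                   ≡⟨ cong (λ c → posPart (c ℤ.- + i)) hi≡2n+1 ⟨
    posPart (ℤ.- + n ℤ.+ + (n + suc (n + n)) ℤ.- + i) ∎)
    where
    open ≤-Reasoning
    above-lo : posPart (+ i ℤ.- ℤ.- + n) ≡ i + n
    above-lo = cong (λ c → posPart (+ i ℤ.+ c)) (ℤₚ.neg-involutive (+ n))
    cancel : ∀ x y → ℤ.- x ℤ.+ (x ℤ.+ y) ≡ y
    cancel = ℤ-solve
    hi≡2n+1 : ℤ.- + n ℤ.+ + (n + suc (n + n)) ≡ + suc (n + n)
    hi≡2n+1 = cancel (+ n) (+ suc (n + n))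
    n+i≤2n+1 : n + i ≤ suc (n + n)
    n+i≤2n+1 = ≤-trans (+-monoʳ-≤ n i≤n) (n≤1+n _)

  n≤boxDepth[i,0] : ∀ {i} → i ≤ n → n ≤ boxDepth (+ i , + 0)
  n≤boxDepth[i,0] i≤n = ⊓-glb (n≤depth i≤n) (n≤depth z≤n)

  n≤boxDepth[0,i] : ∀ {i} → i ≤ n → n ≤ boxDepth (+ 0 , + i)
  n≤boxDepth[0,i] i≤n = ⊓-glb (n≤depth z≤n) (n≤depth i≤n)

  sumFrom≤boxSum-row₀ : ∀ f h → (∀ i → i < n → h i ≤ f (+ i , + 0)) → sumFrom h 0 n ≤ boxSum f
  sumFrom≤boxSum-row₀ f h h≤f = begin
    sumFrom h 0 n                                  ≤⟨ sumFrom-≤-∑-range h _ 0 n (λ i _ → h≤f i) ⟩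
    ∑[ c ∈ range (+ 0) n ] f (c , + 0)             ≡⟨ cong (λ z → ∑[ c ∈ range z n ] f (c , z)) lo+n≡0 ⟨
    ∑[ c ∈ range (ℤ.- + n ℤ.+ + n) n ] f (c , ℤ.- + n ℤ.+ + n) ≤⟨ boxSum-row f n n n n<len n+n≤len ⟩
    boxSum f                                       ∎
    where open ≤-Reasoning

  sumFrom≤boxSum-column₀ : ∀ f h → (∀ i → i < n → h i ≤ f (+ 0 , + i)) → sumFrom h 0 n ≤ boxSum f
  sumFrom≤boxSum-column₀ f h h≤f = begin
    sumFrom h 0 n                                  ≤⟨ sumFrom-≤-∑-range h _ 0 n (λ i _ → h≤f i) ⟩
    ∑[ c ∈ range (+ 0) n ] f (+ 0 , c)             ≡⟨ cong (λ z → ∑[ c ∈ range z n ] f (z , c)) lo+n≡0 ⟨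
    ∑[ c ∈ range (ℤ.- + n ℤ.+ + n) n ] f (ℤ.- + n ℤ.+ + n , c) ≤⟨ boxSum-column f n n n n<len n+n≤len ⟩
    boxSum f                                       ∎
    where open ≤-Reasoning

  edge₀[i,0] : ∀ {i} → i < n → edge f0 n (+ i , + 0) ≡ true
  edge₀[i,0] {i} i<n =
    cong₂ _∧_ (⌊⌋-true (+ 0 ℤ.≟ + 0) refl)
              (cong₂ _∧_ (⌊⌋-true (+ 0 ℤ.≤? + i) (ℤ.+≤+ z≤n))
                         (⌊⌋-true (+ i ℤ.+ + 1 ℤ.≤? + n) (ℤ.+≤+ (subst (_≤ n) (+-comm 1 i) i<n))))

  -- Both sides unfold to the same Boolean.
  edge₁[0,i] : ∀ {i} → i < n → edge (fs f0) n (+ 0 , + i) ≡ true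
  edge₁[0,i] = edge₀[i,0]

  xWeight diagonalWeight : Point → ℕ
  xWeight        p = posPart (proj₁ p) ⊓ boxDepth p
  diagonalWeight p = posPart (+ n ℤ.- (proj₁ p ℤ.+ proj₂ p ℤ.+ + 1)) ⊓ boxDepth p

  xWeight-triangleLipschitz : TriangleLipschitz xWeight
  xWeight-triangleLipschitz = ⊓-triangleLipschitz (posPart ∘ proj₁) boxDepth
    (posPart-affine-triangleLipschitz proj₁ (+ 0) (+ 1) (+ 0) λ (x , y) → x≡affine x y)
    boxDepth-triangleLipschitz
    where
    x≡affine : ∀ x y → x ≡ + 0 ℤ.+ (+ 1 ℤ.* x ℤ.+ + 0 ℤ.* y)
    x≡affine = ℤ-solve

  diagonalWeight-triangleLipschitz : TriangleLipschitz diagonalWeight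
  diagonalWeight-triangleLipschitz = ⊓-triangleLipschitz (posPart ∘ diagonal) boxDepth
    (posPart-affine-triangleLipschitz diagonal (+ n ℤ.- + 1) (ℤ.- + 1) (ℤ.- + 1)
      λ (x , y) → diagonal≡affine (+ n) x y)
    boxDepth-triangleLipschitz
    where
    diagonal : Point → ℤ
    diagonal p = + n ℤ.- (proj₁ p ℤ.+ proj₂ p ℤ.+ + 1)
    diagonal≡affine : ∀ c x y → c ℤ.- (x ℤ.+ y ℤ.+ + 1)
                              ≡ (c ℤ.- + 1) ℤ.+ (ℤ.- + 1 ℤ.* x ℤ.+ ℤ.- + 1 ℤ.* y)
    diagonal≡affine = ℤ-solve

  i≤xWeight[i,0] : ∀ {i} → i < n → i ≤ xWeight (+ i , + 0)
  i≤xWeight[i,0] i<n = ⊓-glb ≤-refl (≤-trans (<⇒≤ i<n) (n≤boxDepth[i,0] (<⇒≤ i<n)))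

  n∸1+i≤diagonalWeight[i,0] : ∀ {i} → i < n → n ∸ suc i ≤ diagonalWeight (+ i , + 0)
  n∸1+i≤diagonalWeight[i,0] {i} i<n = ⊓-glb
    (≤-reflexive (sym (trans (posPart[m-n]≡m∸n n (i + 0 + 1))
                             (cong (n ∸_) (trans (cong (_+ 1) (+-identityʳ i)) (+-comm i 1))))))
    (≤-trans (m∸n≤m n (suc i)) (n≤boxDepth[i,0] (<⇒≤ i<n)))

  n∸1+i≤diagonalWeight[0,i] : ∀ {i} → i < n → n ∸ suc i ≤ diagonalWeight (+ 0 , + i)
  n∸1+i≤diagonalWeight[0,i] {i} i<n = ⊓-glb
    (≤-reflexive (sym (trans (posPart[m-n]≡m∸n n (i + 1)) (cong (n ∸_) (+-comm i 1)))))
    (≤-trans (m∸n≤m n (suc i)) (n≤boxDepth[0,i] (<⇒≤ i<n)))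

  xWeight-vanishes-on-edge₁ : ∀ p → (if edge (fs f0) n p then xWeight p else 0) ≡ 0
  xWeight-vanishes-on-edge₁ (a , b) with a ℤ.≟ + 0
  ... | yes refl = if-0 _
  ... | no _     = refl

  diagonalWeight-vanishes-on-edge₂ : ∀ p → (if edge (fs (fs f0)) n p then diagonalWeight p else 0) ≡ 0
  diagonalWeight-vanishes-on-edge₂ (a , b) with a ℤ.+ b ℤ.+ + 1 ℤ.≟ + n
  ... | yes a+b+1≡n rewrite a+b+1≡n | ℤₚ.+-inverseʳ (+ n) = if-0 _
  ... | no _        rewrite ∧-zeroʳ ⌊ + 0 ℤ.≤? b ⌋ | ∧-zeroʳ ⌊ + 0 ℤ.≤? a ⌋ = refl

  module X = Potential xWeight (⊓-boxDepth-supported _) xWeight-triangleLipschitz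
  module D = Potential diagonalWeight (⊓-boxDepth-supported _) diagonalWeight-triangleLipschitz

  triangular≤X[edge₀] : triangular n ≤ X.Φ (edge f0 n)
  triangular≤X[edge₀] =
    sumFrom≤boxSum-row₀ _ (λ i → i) λ i i<n → ≤-if-true (edge₀[i,0] i<n) (i≤xWeight[i,0] i<n)

  triangular≤D[edge₀] : triangular n ≤ D.Φ (edge f0 n)
  triangular≤D[edge₀] = subst (_≤ D.Φ (edge f0 n)) (sumFrom-reflect n)
    (sumFrom≤boxSum-row₀ _ _ λ i i<n → ≤-if-true (edge₀[i,0] i<n) (n∸1+i≤diagonalWeight[i,0] i<n))

  triangular≤D[edge₁] : triangular n ≤ D.Φ (edge (fs f0) n)
  triangular≤D[edge₁] = subst (_≤ D.Φ (edge (fs f0) n)) (sumFrom-reflect n)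
    (sumFrom≤boxSum-column₀ _ _ λ i i<n → ≤-if-true (edge₁[0,i] i<n) (n∸1+i≤diagonalWeight[0,i] i<n))

  MovesBetween : ℕ → Fin 3 → Fin 3 → Set
  MovesBetween k i j = Moves k (edge i n) (edge j n) ⊎ Moves k (edge j n) (edge i n)

  separation₀₁ : ∀ {k} → MovesBetween k f0 (fs f0) → triangular n ≤ k
  separation₀₁ = X.separation (triangular n) triangular≤X[edge₀] (boxSum-zero xWeight-vanishes-on-edge₁)

  separation₀₂ : ∀ {k} → MovesBetween k f0 (fs (fs f0)) → triangular n ≤ k
  separation₀₂ = D.separation (triangular n) triangular≤D[edge₀] (boxSum-zero diagonalWeight-vanishes-on-edge₂)

  separation₁₂ : ∀ {k} → MovesBetween k (fs f0) (fs (fs f0)) → triangular n ≤ k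
  separation₁₂ = D.separation (triangular n) triangular≤D[edge₁] (boxSum-zero diagonalWeight-vanishes-on-edge₂)

edges-far-apart : ∀ n {i j} → i ≢ j → ∀ {k} → Moves k (edge i n) (edge j n) → triangular n ≤ k
edges-far-apart n {f0}         {f0}         i≢j = ⊥-elim (i≢j refl)
edges-far-apart n {fs f0}      {fs f0}      i≢j = ⊥-elim (i≢j refl)
edges-far-apart n {fs (fs f0)} {fs (fs f0)} i≢j = ⊥-elim (i≢j refl)
edges-far-apart n {f0}         {fs f0}      _   = Edges.separation₀₁ n ∘ inj₁
edges-far-apart n {fs f0}      {f0}         _   = Edges.separation₀₁ n ∘ inj₂
edges-far-apart n {f0}         {fs (fs f0)} _   = Edges.separation₀₂ n ∘ inj₁
edges-far-apart n {fs (fs f0)} {f0}         _   = Edges.separation₀₂ n ∘ inj₂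
edges-far-apart n {fs f0}      {fs (fs f0)} _   = Edges.separation₁₂ n ∘ inj₁
edges-far-apart n {fs (fs f0)} {fs f0}      _   = Edges.separation₁₂ n ∘ inj₂

corollary3 : Σ ℕ λ m → 0 < m × Σ ℕ λ N → ∀ n → N ≤ n →
    ∀ (i j : Fin 3) → i ≢ j → ∀ k → Moves k (edge i n) (edge j n) →
    n * n ≤ m * k
corollary3 = 4 , z<s , 2 , λ n 2≤n i j i≢j k moves →
  ≤-trans (square≤4*triangular n 2≤n) (*-monoʳ-≤ 4 (edges-far-apart n i≢j moves))
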